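{- For every formula $\phi$ of $\mathcal{RCD}$, the formula $R_{\textsc{ag}}C_{\textsc{ag}}\phi\leftrightarrow R_{\textsc{ag}}D_{\textsc{ag}}\phi$ is valid, where $\textsc{ag}$ is the set of all agents.
   Context: Fix a countable set $\textsc{prop}$ of propositional variables and a finite set $\textsc{ag}$ of agents; groups are nonempty subsets of $\textsc{ag}$. The language $\mathcal{RCD}$ is $\phi ::= p \mid \neg\phi \mid \phi\wedge\phi \mid K_i\phi \mid D_G\phi \mid C_G\phi \mid R_G\phi$. A model is $\mathfrak{M}=(S,\sim,V)$ with each $\sim_i$ an equivalence relation on $S$ and $V:\textsc{prop}\to 2^S$; $\sim_G=\bigcap_{i\in G}\sim_i$. The $G$-resolved update is $\mathfrak{M}|_G=(S,\sim|_G,V)$ with $(\sim|_G)_i=\sim_G$ for $i\in G$ and $\sim_i$ otherwise. Satisfaction: atoms via $V$; Booleans as usual; $K_i\phi$ at $s$ iff $\phi$ at all $t$ with $s\sim_it$; $D_G\phi$ iff $\phi$ at all $t$ with $s\sim_Gt$; $C_G\phi$ iff $\phi$ at all $t$ reachable from $s$ via the reflexive transitive closure of $\bigcup_{i\in G}\sim_i$; $\mathfrak{M},s\models R_G\phi$ iff $\mathfrak{M}|_G,s\models\phi$. Valid = true at every state of every model. -}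

module Defs where

open import Data.Nat using (ℕ)
open import Data.Fin using (Fin)
open import Data.Fin.Subset using (Subset; _∈_; Nonempty; ⊤)
open import Data.Vec using (lookup)
open import Data.Bool using (true; false)
open import Data.Product using (Σ; _×_; _,_)
open import Data.Empty using (⊥)
open import Relation.Binary.Structures using (IsEquivalence)
open import Relation.Binary.Construct.Closure.ReflexiveTransitive using (Star)

Group : ℕ → Set
Group n = Σ (Subset n) Nonempty

data Form (n : ℕ) : Set where
  var  : ℕ → Form n
  ¬'_  : Form n → Form n
  _∧'_ : Form n → Form n → Form n
  K    : Fin n → Form n → Form n
  D    : Group n → Form n → Form n
  C    : Group n → Form n → Form n
  R    : Group n → Form n → Form n

Rels : ℕ → Set → Set₁
Rels n S = Fin n → S → S → Set

relD : ∀ {n S} → Rels n S → Subset n → S → S → Set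
relD rel G s t = ∀ i → i ∈ G → rel i s t

relU : ∀ {n S} → Rels n S → Subset n → S → S → Set
relU rel G s t = Σ (Fin _) λ i → i ∈ G × rel i s t

update : ∀ {n S} → Rels n S → Subset n → Rels n S
update rel G i with lookup G i
... | true  = relD rel G
... | false = rel i

sat : ∀ {n} {S : Set} → Rels n S → (ℕ → S → Set) → Form n → S → Set
sat rel V (var p)   s = V p s
sat rel V (¬' φ)    s = sat rel V φ s → ⊥
sat rel V (φ ∧' ψ)  s = sat rel V φ s × sat rel V ψ s
sat rel V (K i φ)   s = ∀ t → rel i s t → sat rel V φ t
sat rel V (D (G , _) φ) s = ∀ t → relD rel G s t → sat rel V φ t
sat rel V (C (G , _) φ) s = ∀ t → Star (relU rel G) s t → sat rel V φ t
sat rel V (R (G , _) φ) s = sat (update rel G) V φ s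

record Model (n : ℕ) : Set₁ where
  field
    S     : Set
    rel   : Rels n S
    isEq  : ∀ i → IsEquivalence (rel i)
    V     : ℕ → S → Set

module Submission where

open import Defs
open import Data.Nat using (ℕ)
open import Data.Fin.Subset using (⊤; Nonempty; _∈_)
open import Data.Product using (_,_)
open import Data.Bool using (true; false)
open import Data.Vec using (lookup)
open import Data.Vec.Properties using ([]=⇒lookup)
open import Function using (id)
open import Function.Bundles using (_⇔_; mk⇔; module Equivalence)
open import Relation.Binary.Core using (_⇒_)
open import Relation.Binary.PropositionalEquality using (refl)
open import Relation.Binary.Structures using (IsEquivalence)
open import Relation.Binary.Construct.Closure.ReflexiveTransitive using (Star; ε; _◅_; fold)

-- In M|_G every agent of G sees exactly ∼_G, so the distributed relation of G
-- in M|_G is ∼_G again, and the common-knowledge relation of G in M|_G is the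
-- reflexive-transitive closure of ∼_G, which is ∼_G itself since ∼_G is an
-- equivalence. Hence C_G and D_G agree after the G-resolution, for every group G.

module _ {n : ℕ} {S : Set} (rel : Rels n S) where

  update-∈ : ∀ {G i} → i ∈ G → ∀ {s t} → update rel G i s t ⇔ relD rel G s t
  update-∈ {G} {i} i∈G with lookup G i | []=⇒lookup i∈G
  ... | true  | refl = mk⇔ id id
  ... | false | ()

  relD⇒relD-update : ∀ {G} → relD rel G ⇒ relD (update rel G) G
  relD⇒relD-update s∼t i i∈G = Equivalence.from (update-∈ i∈G) s∼t

  relD⇒Star-relU : ∀ {G} → Nonempty G → relD rel G ⇒ Star (relU rel G)
  relD⇒Star-relU (i , i∈G) s∼t = (i , i∈G , s∼t i i∈G) ◅ ε

  module _ (isEq : ∀ i → IsEquivalence (rel i)) where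

    relD-isEquivalence : ∀ G → IsEquivalence (relD rel G)
    relD-isEquivalence G = record
      { refl  = λ i _ → IsEquivalence.refl (isEq i)
      ; sym   = λ s∼t i i∈G → IsEquivalence.sym (isEq i) (s∼t i i∈G)
      ; trans = λ s∼t t∼u i i∈G → IsEquivalence.trans (isEq i) (s∼t i i∈G) (t∼u i i∈G)
      }

    Star-relU-update⇒relD : ∀ G → Star (relU (update rel G) G) ⇒ relD rel G
    Star-relU-update⇒relD G = fold (relD rel G) step (IsEquivalence.refl (relD-isEquivalence G))
      where
      step : ∀ {s t u} → relU (update rel G) G s t → relD rel G t u → relD rel G s u
      step (i , i∈G , s∼t) = IsEquivalence.trans (relD-isEquivalence G)
                               (Equivalence.to (update-∈ i∈G) s∼t)

resolved-C⇔resolved-D : ∀ {n} (M : Model n) (G : Group n) (φ : Form n) (s : Model.S M) →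
  sat (Model.rel M) (Model.V M) (R G (C G φ)) s ⇔ sat (Model.rel M) (Model.V M) (R G (D G φ)) s
resolved-C⇔resolved-D M (G , ne) φ s = mk⇔
  (λ Cφ t s∼t → Cφ t (relD⇒Star-relU (update rel G) ne s∼t))
  (λ Dφ t s⇝t → Dφ t (relD⇒relD-update rel (Star-relU-update⇒relD rel isEq G s⇝t)))
  where open Model M

proposition3 : (n : ℕ) → (ne : Nonempty (⊤ {n})) → (φ : Form n) → (M : Model n) →
    (s : Model.S M) →
    sat (Model.rel M) (Model.V M) (R (⊤ , ne) (C (⊤ , ne) φ)) s ⇔
      sat (Model.rel M) (Model.V M) (R (⊤ , ne) (D (⊤ , ne) φ)) s
proposition3 n ne φ M s = resolved-C⇔resolved-D M (⊤ , ne) φ s
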